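{- Let $m,n\in\mathbb N_0$ with $m+n>0$. Then $$\sum_{i=0}^{m+1}\binom{m+1}i (n+i+1)E_{n+i}(0)+(-1)^{m+n}\sum_{j=0}^{n+1}\binom{n+1}j (m+j+1)E_{m+j}(0)=0.$$
   Context: The Euler polynomials $E_n(a)$ are defined by $\frac{2e^{at}}{e^t+1}=\sum_{n=0}^\infty E_n(a)\frac{t^n}{n!}$; $\binom{N}{i}$ denotes the binomial coefficient. -}

module Defs where

open import Data.Nat using (ℕ; zero; suc)
open import Data.Nat.Combinatorics using (_C_)
open import Data.Rational using (ℚ; 0ℚ; 1ℚ; _+_; _-_; _*_; -_; ½)
open import Data.List using (List; []; _∷_; map; foldr; upTo)

sumTo : ℕ → (ℕ → ℚ) → ℚ
sumTo zero    f = f zero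
sumTo (suc n) f = sumTo n f + f (suc n)

sumBelow : ℕ → (ℕ → ℚ) → ℚ
sumBelow zero    f = 0ℚ
sumBelow (suc n) f = sumBelow n f + f n

ℕ→ℚ : ℕ → ℚ
ℕ→ℚ zero    = 0ℚ
ℕ→ℚ (suc n) = ℕ→ℚ n + 1ℚ

sign : ℕ → ℚ
sign zero    = 1ℚ
sign (suc n) = - sign n

-- Euler values E_n(0), determined by the generating function
-- 2/(e^t+1) = Σ E_n(0) t^n/n!, i.e. (e^t + 1) Σ E_n(0) t^n/n! = 2.
-- Comparing coefficients of t^n/n!:
--   Σ_{k≤n} C(n,k) E_k(0) + E_n(0) = 2·[n = 0],
-- so E_n(0) = ½ (2·[n=0] − Σ_{k<n} C(n,k) E_k(0)).
-- Defined via the full list of values (E_0(0), ..., E_n(0)) for structural recursion.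
-- lookup in a list (index k; default 0 if out of range)
nth : List ℚ → ℕ → ℚ
nth []       _       = 0ℚ
nth (x ∷ xs) zero    = x
nth (x ∷ xs) (suc k) = nth xs k

snoc : List ℚ → ℚ → List ℚ
snoc []       y = y ∷ []
snoc (x ∷ xs) y = x ∷ snoc xs y

nextE : ℕ → List ℚ → ℚ
nextE zero    prev = 1ℚ
nextE (suc m) prev =
  - (½ * sumBelow (suc m) (λ k → ℕ→ℚ (suc m C k) * nth prev k))

eulerUpTo : ℕ → List ℚ
eulerUpTo zero    = 1ℚ ∷ []
eulerUpTo (suc n) = snoc (eulerUpTo n) (nextE (suc n) (eulerUpTo n))

E0 : ℕ → ℚ
E0 n = nth (eulerUpTo n) n

-- Put 𝔼 M N = Σ_{i≤M} C(M,i) E_{N+i}(0).  Binomial transforms of sequences are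
-- exactly the arrays obeying Pascal's rule F (M+1) N = F M N + F M (N+1), so an
-- array is determined by its row 0.  The recurrence defining E_n(0) says
-- 𝔼 M 0 = -E_M(0) for M > 0, and from this one gets the reflection symmetry
-- 𝔼 M N = (-1)^(M+N) 𝔼 N M: the defect of the symmetry is again a Pascal array,
-- and its row 0 vanishes by strong induction.  The weights (k+1) in the
-- corollary are absorbed by Σ C(M+1,i)(N+i+1) x_{N+i} = (N+1) T (M+1) N
-- + (M+1) T M (N+1) for the transform T of x, after which the symmetry makes
-- the two sums of the corollary negatives of each other up to (-1)^(m+n).
module Submission where

open import Defs
open import Data.Nat using (ℕ; zero; suc; _<_; _≤_; z≤n; s≤s) renaming (_+_ to _+ℕ_)
import Data.Nat.Properties as ℕ
open import Data.Nat.Combinatorics using (_C_; nCk+nC[k+1]≡[n+1]C[k+1]; k>n⇒nCk≡0; nCn≡1)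
open import Data.Nat.Induction using (<-rec)
open import Data.Rational using (ℚ; 0ℚ; 1ℚ; _+_; _-_; _*_; -_; ½)
open import Data.Rational.Properties using (+-assoc; +-identityʳ; *-distribʳ-+; *-identityˡ; *-zeroˡ; *-zeroʳ; +-0-group)
open import Data.Rational.Solver using (module +-*-Solver)
open import Algebra.Properties.Group +-0-group using (x∙y⁻¹≈ε⇒x≈y)
open import Data.List using (List; []; _∷_; length)
open import Data.Sum using (_⊎_; inj₁; inj₂)
open import Relation.Nullary using (yes; no)
open import Relation.Binary.PropositionalEquality using (_≡_; refl; sym; trans; cong; cong₂; subst; module ≡-Reasoning)
open +-*-Solver
open ≡-Reasoning

sumTo-cong : ∀ n {f g : ℕ → ℚ} → (∀ i → f i ≡ g i) → sumTo n f ≡ sumTo n g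
sumTo-cong zero    f≡g = f≡g zero
sumTo-cong (suc n) f≡g = cong₂ _+_ (sumTo-cong n f≡g) (f≡g (suc n))

sumTo-sucˡ : ∀ n (f : ℕ → ℚ) → sumTo (suc n) f ≡ f 0 + sumTo n (λ i → f (suc i))
sumTo-sucˡ zero    f = refl
sumTo-sucˡ (suc n) f = trans (cong (_+ f (suc (suc n))) (sumTo-sucˡ n f))
  (+-assoc (f 0) (sumTo n (λ i → f (suc i))) (f (suc (suc n))))

sumTo-distrib-+ : ∀ n (f g : ℕ → ℚ) → sumTo n (λ i → f i + g i) ≡ sumTo n f + sumTo n g
sumTo-distrib-+ zero    f g = refl
sumTo-distrib-+ (suc n) f g = trans (cong (_+ (f (suc n) + g (suc n))) (sumTo-distrib-+ n f g))
  (solve 4 (λ a b c d → (a :+ b) :+ (c :+ d) := (a :+ c) :+ (b :+ d)) refl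
     (sumTo n f) (sumTo n g) (f (suc n)) (g (suc n)))

sumTo≡sumBelow+last : ∀ n (f : ℕ → ℚ) → sumTo n f ≡ sumBelow n f + f n
sumTo≡sumBelow+last zero    f = solve 1 (λ a → a := con 0ℚ :+ a) refl (f 0)
sumTo≡sumBelow+last (suc n) f = cong (_+ f (suc n)) (sumTo≡sumBelow+last n f)

sumBelow-cong : ∀ n {f g : ℕ → ℚ} → (∀ {i} → i < n → f i ≡ g i) → sumBelow n f ≡ sumBelow n g
sumBelow-cong zero    f≡g = refl
sumBelow-cong (suc n) f≡g =
  cong₂ _+_ (sumBelow-cong n (λ i<n → f≡g (ℕ.m<n⇒m<1+n i<n))) (f≡g (ℕ.n<1+n n))

sumBelow-zero : ∀ n (f : ℕ → ℚ) → (∀ {i} → i < n → f i ≡ 0ℚ) → sumBelow n f ≡ 0ℚ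
sumBelow-zero n f f≡0 = trans (sumBelow-cong n f≡0) (sumBelow-0 n)
  where
  sumBelow-0 : ∀ n → sumBelow n (λ _ → 0ℚ) ≡ 0ℚ
  sumBelow-0 zero    = refl
  sumBelow-0 (suc n) = cong (_+ 0ℚ) (sumBelow-0 n)

ℕ→ℚ-homo-+ : ∀ m n → ℕ→ℚ (m +ℕ n) ≡ ℕ→ℚ m + ℕ→ℚ n
ℕ→ℚ-homo-+ zero    n = solve 1 (λ x → x := con 0ℚ :+ x) refl (ℕ→ℚ n)
ℕ→ℚ-homo-+ (suc m) n = trans (cong (_+ 1ℚ) (ℕ→ℚ-homo-+ m n))
  (solve 2 (λ x y → (x :+ y) :+ con 1ℚ := (x :+ con 1ℚ) :+ y) refl (ℕ→ℚ m) (ℕ→ℚ n))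

x≡-x⇒x≡0 : ∀ x → x ≡ - x → x ≡ 0ℚ
x≡-x⇒x≡0 x x≡-x = begin
  x               ≡⟨ solve 1 (λ x → x := con ½ :* (x :+ :- (:- x))) refl x ⟩
  ½ * (x + - - x) ≡⟨ cong (λ v → ½ * (x + - v)) (sym x≡-x) ⟩
  ½ * (x + - x)   ≡⟨ solve 1 (λ x → con ½ :* (x :+ :- x) := con 0ℚ) refl x ⟩
  0ℚ              ∎

sign²≡1 : ∀ n → sign n * sign n ≡ 1ℚ
sign²≡1 zero    = refl
sign²≡1 (suc n) = trans (solve 1 (λ s → (:- s) :* (:- s) := s :* s) refl (sign n)) (sign²≡1 n)

sign≡1⊎sign≡-1 : ∀ n → sign n ≡ 1ℚ ⊎ sign n ≡ - 1ℚ
sign≡1⊎sign≡-1 zero = inj₁ refl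
sign≡1⊎sign≡-1 (suc n) with sign≡1⊎sign≡-1 n
... | inj₁ s≡1  = inj₂ (cong -_ s≡1)
... | inj₂ s≡-1 = inj₁ (cong -_ s≡-1)

x+sy≡0 : ∀ s x y → s * s ≡ 1ℚ → y ≡ - s * x → x + s * y ≡ 0ℚ
x+sy≡0 s x y s²≡1 y≡-sx = begin
  x + s * y                  ≡⟨ cong (λ v → x + s * v) y≡-sx ⟩
  x + s * (- s * x)          ≡⟨ solve 2 (λ s x → x :+ s :* (:- s :* x) := (con 1ℚ :- s :* s) :* x) refl s x ⟩
  (1ℚ - s * s) * x           ≡⟨ cong (λ v → (1ℚ - v) * x) s²≡1 ⟩
  (1ℚ - 1ℚ) * x              ≡⟨ solve 1 (λ x → (con 1ℚ :- con 1ℚ) :* x := con 0ℚ) refl x ⟩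
  0ℚ                         ∎

binomialTransform : (ℕ → ℚ) → ℕ → ℕ → ℚ
binomialTransform x M N = sumTo M (λ i → ℕ→ℚ (M C i) * x (N +ℕ i))

IsPascal : (ℕ → ℕ → ℚ) → Set
IsPascal F = ∀ M N → F (suc M) N ≡ F M N + F M (suc N)

binomialTransform-row0 : ∀ x N → binomialTransform x 0 N ≡ x N
binomialTransform-row0 x N = trans (*-identityˡ _) (cong x (ℕ.+-identityʳ N))

binomialTransform-isPascal : ∀ x → IsPascal (binomialTransform x)
binomialTransform-isPascal x M N = begin
    T (suc M) N
  ≡⟨ sumTo-sucˡ M _ ⟩
    x₀ + sumTo M (λ i → ℕ→ℚ (suc M C suc i) * x (N +ℕ suc i))
  ≡⟨ cong (x₀ +_) (trans (sumTo-cong M pascal-term) (sumTo-distrib-+ M _ _)) ⟩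
    x₀ + (T M (suc N) + S)
  ≡⟨ solve 3 (λ a b c → a :+ (b :+ c) := (a :+ c) :+ b) refl x₀ (T M (suc N)) S ⟩
    (x₀ + S) + T M (suc N)
  ≡⟨ cong (_+ T M (suc N)) x₀+S≡T ⟩
    T M N + T M (suc N)
  ∎
  where
  T : ℕ → ℕ → ℚ
  T = binomialTransform x
  x₀ S : ℚ
  x₀ = 1ℚ * x (N +ℕ 0)
  S = sumTo M (λ i → ℕ→ℚ (M C suc i) * x (N +ℕ suc i))
  pascal-term : ∀ i → ℕ→ℚ (suc M C suc i) * x (N +ℕ suc i)
                    ≡ ℕ→ℚ (M C i) * x (suc N +ℕ i) + ℕ→ℚ (M C suc i) * x (N +ℕ suc i)
  pascal-term i = begin
      ℕ→ℚ (suc M C suc i) * x (N +ℕ suc i)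
    ≡⟨ cong (λ k → ℕ→ℚ k * x (N +ℕ suc i)) (sym (nCk+nC[k+1]≡[n+1]C[k+1] M i)) ⟩
      ℕ→ℚ (M C i +ℕ M C suc i) * x (N +ℕ suc i)
    ≡⟨ cong (_* x (N +ℕ suc i)) (ℕ→ℚ-homo-+ (M C i) (M C suc i)) ⟩
      (ℕ→ℚ (M C i) + ℕ→ℚ (M C suc i)) * x (N +ℕ suc i)
    ≡⟨ *-distribʳ-+ (x (N +ℕ suc i)) (ℕ→ℚ (M C i)) (ℕ→ℚ (M C suc i)) ⟩
      ℕ→ℚ (M C i) * x (N +ℕ suc i) + ℕ→ℚ (M C suc i) * x (N +ℕ suc i)
    ≡⟨ cong (λ k → ℕ→ℚ (M C i) * x k + ℕ→ℚ (M C suc i) * x (N +ℕ suc i)) (ℕ.+-suc N i) ⟩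
      ℕ→ℚ (M C i) * x (suc N +ℕ i) + ℕ→ℚ (M C suc i) * x (N +ℕ suc i)
    ∎
  x₀+S≡T : x₀ + S ≡ T M N
  x₀+S≡T = begin
      x₀ + S
    ≡⟨ sym (sumTo-sucˡ M _) ⟩
      T M N + ℕ→ℚ (M C suc M) * x (N +ℕ suc M)
    ≡⟨ cong (λ k → T M N + ℕ→ℚ k * x (N +ℕ suc M)) (k>n⇒nCk≡0 (ℕ.n<1+n M)) ⟩
      T M N + 0ℚ * x (N +ℕ suc M)
    ≡⟨ cong (T M N +_) (*-zeroˡ (x (N +ℕ suc M))) ⟩
      T M N + 0ℚ
    ≡⟨ +-identityʳ _ ⟩
      T M N
    ∎

binomialTransform-leading : ∀ x M → (∀ {i} → i < M → x i ≡ 0ℚ) → binomialTransform x M 0 ≡ x M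
binomialTransform-leading x M x<M≡0 = begin
    binomialTransform x M 0
  ≡⟨ sumTo≡sumBelow+last M _ ⟩
    sumBelow M (λ i → ℕ→ℚ (M C i) * x i) + ℕ→ℚ (M C M) * x M
  ≡⟨ cong₂ (λ u k → u + ℕ→ℚ k * x M) (sumBelow-zero M _ lower≡0) (nCn≡1 M) ⟩
    0ℚ + 1ℚ * x M
  ≡⟨ solve 1 (λ v → con 0ℚ :+ con 1ℚ :* v := v) refl (x M) ⟩
    x M
  ∎
  where
  lower≡0 : ∀ {i} → i < M → ℕ→ℚ (M C i) * x i ≡ 0ℚ
  lower≡0 {i} i<M = trans (cong (ℕ→ℚ (M C i) *_) (x<M≡0 i<M)) (*-zeroʳ (ℕ→ℚ (M C i)))

IsPascal-unique : ∀ {F G} → IsPascal F → IsPascal G → (∀ N → F 0 N ≡ G 0 N) → ∀ M N → F M N ≡ G M N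
IsPascal-unique         pF pG F₀≡G₀ zero    N = F₀≡G₀ N
IsPascal-unique {F} {G} pF pG F₀≡G₀ (suc M) N = begin
  F (suc M) N         ≡⟨ pF M N ⟩
  F M N + F M (suc N) ≡⟨ cong₂ _+_ (unique M N) (unique M (suc N)) ⟩
  G M N + G M (suc N) ≡⟨ sym (pG M N) ⟩
  G (suc M) N         ∎
  where
  unique : ∀ M N → F M N ≡ G M N
  unique = IsPascal-unique {F} {G} pF pG F₀≡G₀

IsPascal⇒binomialTransform : ∀ {F} → IsPascal F → ∀ M N → F M N ≡ binomialTransform (F 0) M N
IsPascal⇒binomialTransform {F} pF = IsPascal-unique pF (binomialTransform-isPascal (F 0))
  (λ N → sym (binomialTransform-row0 (F 0) N))

IsPascal-- : ∀ {F G} → IsPascal F → IsPascal G → IsPascal (λ M N → F M N - G M N)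
IsPascal-- {F} {G} pF pG M N = trans (cong₂ _-_ (pF M N) (pG M N))
  (solve 4 (λ a b c d → (a :+ b) :- (c :+ d) := (a :- c) :+ (b :- d)) refl
    (F M N) (F M (suc N)) (G M N) (G M (suc N)))

IsPascal-reflect : ∀ {F} → IsPascal F → IsPascal (λ M N → sign (M +ℕ N) * F N M)
IsPascal-reflect {F} p M N = begin
    - s * F N (suc M)
  ≡⟨ solve 3 (λ s a b → :- s :* b := s :* a :+ (:- s) :* (a :+ b)) refl s (F N M) (F N (suc M)) ⟩
    s * F N M + (- s) * (F N M + F N (suc M))
  ≡⟨ cong₂ (λ s′ v → s * F N M + s′ * v) (cong sign (sym (ℕ.+-suc M N))) (sym (p N M)) ⟩
    s * F N M + sign (M +ℕ suc N) * F (suc N) M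
  ∎
  where
  s : ℚ
  s = sign (M +ℕ N)

shiftedTransform : (ℕ → ℚ) → ℕ → ℕ → ℚ
shiftedTransform x zero    N = 0ℚ
shiftedTransform x (suc M) N = ℕ→ℚ (suc M) * binomialTransform x M (suc N)

weightedTransform-isPascal :
  ∀ x → IsPascal (λ M N → ℕ→ℚ (N +ℕ 1) * binomialTransform x M N + shiftedTransform x M N)
weightedTransform-isPascal x zero N = begin
    p * T 1 N + ℕ→ℚ 1 * T 0 (suc N)
  ≡⟨ cong (λ v → p * v + ℕ→ℚ 1 * T 0 (suc N)) (binomialTransform-isPascal x 0 N) ⟩
    p * (T 0 N + T 0 (suc N)) + ℕ→ℚ 1 * T 0 (suc N)
  ≡⟨ solve 3 (λ p A B → p :* (A :+ B) :+ con 1ℚ :* B := (p :* A :+ con 0ℚ) :+ ((p :+ con 1ℚ) :* B :+ con 0ℚ))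
       refl p (T 0 N) (T 0 (suc N)) ⟩
    (p * T 0 N + 0ℚ) + ((p + 1ℚ) * T 0 (suc N) + 0ℚ)
  ∎
  where
  T : ℕ → ℕ → ℚ
  T = binomialTransform x
  p : ℚ
  p = ℕ→ℚ (N +ℕ 1)
weightedTransform-isPascal x (suc M) N = begin
    p * T (suc (suc M)) N + (r + 1ℚ) * T (suc M) (suc N)
  ≡⟨ cong₂ (λ u v → p * u + (r + 1ℚ) * v)
       (trans (binomialTransform-isPascal x (suc M) N) (cong (A +_) (binomialTransform-isPascal x M (suc N))))
       (binomialTransform-isPascal x M (suc N)) ⟩
    p * (A + (B + C)) + (r + 1ℚ) * (B + C)
  ≡⟨ solve 5 (λ p r A B C → p :* (A :+ (B :+ C)) :+ (r :+ con 1ℚ) :* (B :+ C)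
                := (p :* A :+ r :* B) :+ ((p :+ con 1ℚ) :* (B :+ C) :+ r :* C)) refl p r A B C ⟩
    (p * A + r * B) + ((p + 1ℚ) * (B + C) + r * C)
  ≡⟨ cong (λ v → (p * A + r * B) + ((p + 1ℚ) * v + r * C)) (sym (binomialTransform-isPascal x M (suc N))) ⟩
    (p * A + r * B) + ((p + 1ℚ) * T (suc M) (suc N) + r * C)
  ∎
  where
  T : ℕ → ℕ → ℚ
  T = binomialTransform x
  p r A B C : ℚ
  p = ℕ→ℚ (N +ℕ 1)
  r = ℕ→ℚ (suc M)
  A = T (suc M) N
  B = T M (suc N)
  C = T M (suc (suc N))

binomialTransform-weighted : ∀ x M N →
  binomialTransform (λ k → ℕ→ℚ (k +ℕ 1) * x k) M N
    ≡ ℕ→ℚ (N +ℕ 1) * binomialTransform x M N + shiftedTransform x M N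
binomialTransform-weighted x =
  IsPascal-unique {G = λ M N → ℕ→ℚ (N +ℕ 1) * binomialTransform x M N + shiftedTransform x M N}
    (binomialTransform-isPascal w) (weightedTransform-isPascal x) row0
  where
  w : ℕ → ℚ
  w k = ℕ→ℚ (k +ℕ 1) * x k
  row0 : ∀ N → binomialTransform w 0 N ≡ ℕ→ℚ (N +ℕ 1) * binomialTransform x 0 N + 0ℚ
  row0 N = begin
      binomialTransform w 0 N
    ≡⟨ binomialTransform-row0 w N ⟩
      ℕ→ℚ (N +ℕ 1) * x N
    ≡⟨ cong (ℕ→ℚ (N +ℕ 1) *_) (sym (binomialTransform-row0 x N)) ⟩
      ℕ→ℚ (N +ℕ 1) * binomialTransform x 0 N
    ≡⟨ sym (+-identityʳ _) ⟩
      ℕ→ℚ (N +ℕ 1) * binomialTransform x 0 N + 0ℚ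
    ∎

length-snoc : ∀ (xs : List ℚ) y → length (snoc xs y) ≡ suc (length xs)
length-snoc []       y = refl
length-snoc (x ∷ xs) y = cong suc (length-snoc xs y)

nth-snoc-length : ∀ (xs : List ℚ) y → nth (snoc xs y) (length xs) ≡ y
nth-snoc-length []       y = refl
nth-snoc-length (x ∷ xs) y = nth-snoc-length xs y

nth-snoc-< : ∀ (xs : List ℚ) y {k} → k < length xs → nth (snoc xs y) k ≡ nth xs k
nth-snoc-< (x ∷ xs) y {zero}  _         = refl
nth-snoc-< (x ∷ xs) y {suc k} (s≤s k<n) = nth-snoc-< xs y k<n

length-eulerUpTo : ∀ n → length (eulerUpTo n) ≡ suc n
length-eulerUpTo zero    = refl
length-eulerUpTo (suc n) = trans (length-snoc (eulerUpTo n) _) (cong suc (length-eulerUpTo n))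

nth-eulerUpTo : ∀ n {k} → k ≤ n → nth (eulerUpTo n) k ≡ E0 k
nth-eulerUpTo zero    z≤n = refl
nth-eulerUpTo (suc n) {k} k≤1+n with k ℕ.≟ suc n
... | yes refl = refl
... | no  k≢1+n = trans
  (nth-snoc-< (eulerUpTo n) _ (subst (k <_) (sym (length-eulerUpTo n)) k<1+n))
  (nth-eulerUpTo n (ℕ.≤-pred k<1+n))
  where
  k<1+n : k < suc n
  k<1+n = ℕ.≤∧≢⇒< k≤1+n k≢1+n

E0-suc : ∀ m → E0 (suc m) ≡ - (½ * sumBelow (suc m) (λ k → ℕ→ℚ (suc m C k) * E0 k))
E0-suc m = begin
    nth (snoc Es (nextE (suc m) Es)) (suc m)
  ≡⟨ cong (nth (snoc Es (nextE (suc m) Es))) (sym (length-eulerUpTo m)) ⟩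
    nth (snoc Es (nextE (suc m) Es)) (length Es)
  ≡⟨ nth-snoc-length Es _ ⟩
    nextE (suc m) Es
  ≡⟨ cong (λ v → - (½ * v)) (sumBelow-cong (suc m)
       (λ {k} k<1+m → cong (ℕ→ℚ (suc m C k) *_) (nth-eulerUpTo m (ℕ.≤-pred k<1+m)))) ⟩
    - (½ * sumBelow (suc m) (λ k → ℕ→ℚ (suc m C k) * E0 k))
  ∎
  where
  Es : List ℚ
  Es = eulerUpTo m

eulerArray : ℕ → ℕ → ℚ
eulerArray = binomialTransform E0

-- The generating-function identity (e^t + 1) Σ E_n(0) tⁿ/n! = 2 in degree m+1.
eulerArray-suc-0 : ∀ m → eulerArray (suc m) 0 ≡ - E0 (suc m)
eulerArray-suc-0 m = begin
    eulerArray (suc m) 0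
  ≡⟨ sumTo≡sumBelow+last (suc m) _ ⟩
    S + ℕ→ℚ (suc m C suc m) * E0 (suc m)
  ≡⟨ cong (λ k → S + ℕ→ℚ k * E0 (suc m)) (nCn≡1 (suc m)) ⟩
    S + 1ℚ * E0 (suc m)
  ≡⟨ cong (λ v → S + 1ℚ * v) (E0-suc m) ⟩
    S + 1ℚ * (- (½ * S))
  ≡⟨ solve 1 (λ S → S :+ con 1ℚ :* (:- (con ½ :* S)) := :- (:- (con ½ :* S))) refl S ⟩
    - (- (½ * S))
  ≡⟨ cong -_ (sym (E0-suc m)) ⟩
    - E0 (suc m)
  ∎
  where
  S : ℚ
  S = sumBelow (suc m) (λ k → ℕ→ℚ (suc m C k) * E0 k)

eulerDefect : ℕ → ℕ → ℚ
eulerDefect M N = eulerArray M N - sign (M +ℕ N) * eulerArray N M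

eulerDefect-isPascal : IsPascal eulerDefect
eulerDefect-isPascal =
  IsPascal-- {eulerArray} (binomialTransform-isPascal E0) (IsPascal-reflect {eulerArray} (binomialTransform-isPascal E0))

eulerDefect-column0 : ∀ M → eulerDefect M 0 ≡ - sign M * eulerDefect 0 M
eulerDefect-column0 M = begin
    A - sign (M +ℕ 0) * B
  ≡⟨ cong (λ k → A - sign k * B) (ℕ.+-identityʳ M) ⟩
    A - s * B
  ≡⟨ solve 3 (λ s A B → A :- s :* B := (:- s) :* (B :- s :* A) :+ (con 1ℚ :- s :* s) :* A) refl s A B ⟩
    - s * (B - s * A) + (1ℚ - s * s) * A
  ≡⟨ cong (λ v → - s * (B - s * A) + (1ℚ - v) * A) (sign²≡1 M) ⟩
    - s * (B - s * A) + (1ℚ - 1ℚ) * A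
  ≡⟨ solve 2 (λ X A → X :+ (con 1ℚ :- con 1ℚ) :* A := X) refl (- s * (B - s * A)) A ⟩
    - s * (B - s * A)
  ∎
  where
  s A B : ℚ
  s = sign M
  A = eulerArray M 0
  B = eulerArray 0 M

-- In even degree the Pascal expansion of column 0 makes the row-0 entry its own
-- negative; in odd degree it vanishes outright by eulerArray-suc-0.
eulerDefect-row0-even : ∀ n → sign n ≡ 1ℚ → (∀ {i} → i < n → eulerDefect 0 i ≡ 0ℚ) → eulerDefect 0 n ≡ 0ℚ
eulerDefect-row0-even n s≡1 below≡0 = x≡-x⇒x≡0 d (begin
    d
  ≡⟨ sym (binomialTransform-leading (eulerDefect 0) n below≡0) ⟩
    binomialTransform (eulerDefect 0) n 0
  ≡⟨ sym (IsPascal⇒binomialTransform {eulerDefect} eulerDefect-isPascal n 0) ⟩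
    eulerDefect n 0
  ≡⟨ eulerDefect-column0 n ⟩
    - sign n * d
  ≡⟨ cong (λ s → - s * d) s≡1 ⟩
    - 1ℚ * d
  ≡⟨ solve 1 (λ d → :- con 1ℚ :* d := :- d) refl d ⟩
    - d
  ∎)
  where
  d : ℚ
  d = eulerDefect 0 n

eulerDefect-row0-odd : ∀ m → sign (suc m) ≡ - 1ℚ → eulerDefect 0 (suc m) ≡ 0ℚ
eulerDefect-row0-odd m s≡-1 = begin
    eulerArray 0 (suc m) - sign (suc m) * eulerArray (suc m) 0
  ≡⟨ cong₂ (λ u s → u - s * eulerArray (suc m) 0) (binomialTransform-row0 E0 (suc m)) s≡-1 ⟩
    E0 (suc m) - (- 1ℚ) * eulerArray (suc m) 0
  ≡⟨ cong (λ v → E0 (suc m) - (- 1ℚ) * v) (eulerArray-suc-0 m) ⟩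
    E0 (suc m) - (- 1ℚ) * (- E0 (suc m))
  ≡⟨ solve 1 (λ e → e :- (:- con 1ℚ) :* (:- e) := con 0ℚ) refl (E0 (suc m)) ⟩
    0ℚ
  ∎

eulerDefect-row0 : ∀ N → eulerDefect 0 N ≡ 0ℚ
eulerDefect-row0 = <-rec _ step
  where
  step : ∀ n → (∀ {i} → i < n → eulerDefect 0 i ≡ 0ℚ) → eulerDefect 0 n ≡ 0ℚ
  step zero    below≡0 = eulerDefect-row0-even zero refl below≡0
  step (suc m) below≡0 with sign≡1⊎sign≡-1 (suc m)
  ... | inj₁ s≡1  = eulerDefect-row0-even (suc m) s≡1 below≡0
  ... | inj₂ s≡-1 = eulerDefect-row0-odd m s≡-1

eulerArray-reflect : ∀ M N → eulerArray M N ≡ sign (M +ℕ N) * eulerArray N M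
eulerArray-reflect M N = x∙y⁻¹≈ε⇒x≈y _ _
  (IsPascal-unique {eulerDefect} {λ _ _ → 0ℚ} eulerDefect-isPascal (λ _ _ → refl) eulerDefect-row0 M N)

corollary1p4 : (m n : ℕ) → 0 < m +ℕ n →
    sumTo (suc m) (λ i → ℕ→ℚ (suc m C i) * (ℕ→ℚ (n +ℕ i +ℕ 1) * E0 (n +ℕ i)))
    + sign (m +ℕ n) * sumTo (suc n) (λ j → ℕ→ℚ (suc n C j) * (ℕ→ℚ (m +ℕ j +ℕ 1) * E0 (m +ℕ j)))
    ≡ 0ℚ
corollary1p4 m n _ = x+sy≡0 s (W (suc m) n) (W (suc n) m) (sign²≡1 (m +ℕ n)) (begin
    W (suc n) m
  ≡⟨ binomialTransform-weighted E0 (suc n) m ⟩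
    q * eulerArray (suc n) m + ℕ→ℚ (suc n) * eulerArray n (suc m)
  ≡⟨ cong₂ (λ u v → q * u + ℕ→ℚ (suc n) * v) (eulerArray-reflect (suc n) m) (eulerArray-reflect n (suc m)) ⟩
    q * (sign (suc n +ℕ m) * B) + ℕ→ℚ (suc n) * (sign (n +ℕ suc m) * A)
  ≡⟨ cong₂ (λ k l → q * (sign k * B) + l * (sign (n +ℕ suc m) * A)) (cong suc (ℕ.+-comm n m)) (cong ℕ→ℚ (ℕ.+-comm 1 n)) ⟩
    q * (- s * B) + p * (sign (n +ℕ suc m) * A)
  ≡⟨ cong (λ k → q * (- s * B) + p * (sign k * A)) (trans (ℕ.+-suc n m) (cong suc (ℕ.+-comm n m))) ⟩
    q * (- s * B) + p * (- s * A)
  ≡⟨ solve 5 (λ s p q A B → q :* (:- s :* B) :+ p :* (:- s :* A) := :- s :* (p :* A :+ q :* B)) refl s p q A B ⟩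
    - s * (p * A + q * B)
  ≡⟨ cong (λ v → - s * (p * A + v * B)) (cong ℕ→ℚ (ℕ.+-comm m 1)) ⟩
    - s * (p * A + ℕ→ℚ (suc m) * B)
  ≡⟨ cong (- s *_) (sym (binomialTransform-weighted E0 (suc m) n)) ⟩
    - s * W (suc m) n
  ∎)
  where
  W : ℕ → ℕ → ℚ
  W = binomialTransform (λ k → ℕ→ℚ (k +ℕ 1) * E0 k)
  s p q A B : ℚ
  s = sign (m +ℕ n)
  p = ℕ→ℚ (n +ℕ 1)
  q = ℕ→ℚ (m +ℕ 1)
  A = eulerArray (suc m) n
  B = eulerArray m (suc n)
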